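{- Let $G$ and $H$ be finite simple graphs with $\operatorname{im}(G)=t$ and $\operatorname{im}(H)=r$. Then $\operatorname{im}(G\circ H)\geq tr$.
   Context: All graphs are finite and simple. A graph $G$ has a $G'$-immersion if there is an injective map $\phi:V(G')\to V(G)$ such that for every edge $uv\in E(G')$ there is a path in $G$ joining $\phi(u)$ and $\phi(v)$, and these paths are pairwise edge-disjoint. The immersion number $\operatorname{im}(G)$ is the largest $t$ such that $G$ has a $K_t$-immersion. The lexicographic product $G\circ H$ has vertex set $V(G)\times V(H)$, with $(g,h)$ adjacent to $(g',h')$ if and only if $gg'\in E(G)$, or $g=g'$ and $hh'\in E(H)$. -}

module Defs where

open import Data.Nat using (ℕ; _*_; _≤_)
open import Data.Fin using (Fin; _<_; _≟_; remQuot)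
open import Data.Bool using (Bool; true; false; T; not; _∨_; _∧_)
open import Data.Product using (Σ; _×_; _,_; ∃; proj₁; proj₂)
open import Data.List using (List; []; _∷_)
open import Data.List.Membership.Propositional using (_∈_; _∉_)
open import Data.List.Relation.Unary.Unique.Propositional using (Unique)
open import Relation.Binary.PropositionalEquality using (_≡_; _≢_)
open import Relation.Nullary.Decidable using (⌊_⌋)
open import Function.Definitions using (Injective)

Adj : ℕ → Set
Adj n = Fin n → Fin n → Bool

IsSimple : ∀ {n} → Adj n → Set
IsSimple {n} adj = (∀ (i j : Fin n) → adj i j ≡ adj j i) × (∀ (i : Fin n) → adj i i ≡ false)

K : (s : ℕ) → Adj s
K s i j = not ⌊ i ≟ j ⌋

-- Lexicographic product G ∘ H on Fin (n * m); vertex x corresponds to the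
-- pair remQuot m x = (g , h) ∈ Fin n × Fin m (a bijection).
lex : ∀ {n m} → Adj n → Adj m → Adj (n * m)
lex {n} {m} G H x y =
  G (proj₁ (remQuot {n} m x)) (proj₁ (remQuot {n} m y)) ∨
  (⌊ proj₁ (remQuot {n} m x) ≟ proj₁ (remQuot {n} m y) ⌋ ∧ H (proj₂ (remQuot {n} m x)) (proj₂ (remQuot {n} m y)))

data Walk {n} (adj : Adj n) : Fin n → Fin n → Set where
  stay : (u : Fin n) → Walk adj u u
  step : ∀ {u w v} → T (adj u w) → Walk adj w v → Walk adj u v

vertices : ∀ {n} {adj : Adj n} {u v} → Walk adj u v → List (Fin n)
vertices (stay u) = u ∷ []
vertices (step {u = u} _ p) = u ∷ vertices p

edges : ∀ {n} {adj : Adj n} {u v} → Walk adj u v → List (Fin n × Fin n)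
edges (stay u) = []
edges (step {u = u} {w = w} _ p) = (u , w) ∷ edges p

IsPath : ∀ {n} {adj : Adj n} {u v} → Walk adj u v → Set
IsPath p = Unique (vertices p)

EdgeDisjoint : ∀ {n} {adj : Adj n} {u v u' v'} → Walk adj u v → Walk adj u' v' → Set
EdgeDisjoint {n} p q = ∀ (a b : Fin n) → (a , b) ∈ edges p → ((a , b) ∉ edges q) × ((b , a) ∉ edges q)

-- G has a G'-immersion (G' on Fin s, G on Fin n). Each edge of G' is
-- listed once as (i , j) with i < j.
record Immersion {s n} (G' : Adj s) (G : Adj n) : Set where
  field
    φ : Fin s → Fin n
    φ-inj : Injective _≡_ _≡_ φ
    path : (i j : Fin s) → i < j → T (G' i j) → Walk G (φ i) (φ j)
    path-isPath : ∀ i j (lt : i < j) (e : T (G' i j)) → IsPath (path i j lt e)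
    disjoint : ∀ i j k l (lt : i < j) (e : T (G' i j)) (lt' : k < l) (e' : T (G' k l)) →
               (i , j) ≢ (k , l) → EdgeDisjoint (path i j lt e) (path k l lt' e')

HasImmersion : ∀ {s n} → Adj s → Adj n → Set
HasImmersion G' G = Immersion G' G

ImNum : ∀ {n} → Adj n → ℕ → Set
ImNum G t = HasImmersion (K t) G × (∀ s → HasImmersion (K s) G → s ≤ t)

ImAtLeast : ∀ {n} → Adj n → ℕ → Set
ImAtLeast G k = ∃ λ s → k ≤ s × HasImmersion (K s) G

module Submission where

-- The immersion number is supermultiplicative under the lexicographic
-- product: from a K_t-immersion (φ, P) of G and a K_r-immersion (ψ, Q) of H
-- we build a K_{tr}-immersion of G ∘ H, sending the vertex (a , k) of K_{tr}
-- to (φ a , ψ k).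
--   * (a , k) and (a , l) with k < l are joined inside the fibre {φ a} × H
--     by the copy of the H-path Q_{kl}.
--   * (a , k) and (a' , l) with a < a' are joined by a "zigzag" lift of the
--     G-path P_{aa'} = x₀ x₁ … x_s: its vertices are (x₀ , ψ k), then
--     alternately (x_i , ψ (k ⊕ l)) and (x_i , ψ k), and finally (x_s , ψ l),
--     where k ⊕ l is addition modulo r.  Since ⊕ is a Latin square, two
--     different pairs (k , l) never use the same edge over P_{aa'}.

open import Defs
open import Data.Nat as ℕ using (ℕ; _*_; _+_; _∸_; _%_; NonZero)
open import Data.Nat.Properties using (+-assoc; +-comm; m+[n∸m]≡n; <⇒≤; ≤-refl; <-asym; +-cancelˡ-<)
open import Data.Nat.DivMod using (_mod_; %-distribˡ-+; [m+n]%n≡m%n; m<n⇒m%n≡m; m%n<n)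
open import Data.Fin as Fin using (Fin; toℕ; combine; remQuot; _≟_)
open import Data.Fin.Properties
  using (toℕ-fromℕ<; toℕ-injective; toℕ<n; toℕ-combine; combine-monoˡ-<; combine-injective; combine-remQuot; remQuot-combine; <-cmp; <⇒≢; <-irrelevant)
open import Data.Bool using (T; _∨_; _∧_)
open import Data.Bool.Properties using (T-∨; T-∧)
open import Data.Empty using (⊥; ⊥-elim)
open import Data.Product using (_×_; _,_; proj₁; proj₂)
open import Data.Product.Properties using (,-injective)
open import Data.Sum using (_⊎_; inj₁; inj₂)
open import Data.List using ([]; _∷_; map)
open import Data.List.Membership.Propositional using (_∈_)
open import Data.List.Relation.Unary.Any using (here; there)
open import Data.List.Relation.Unary.All as All using (All)
open import Data.List.Relation.Unary.AllPairs using (_∷_)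
open import Data.List.Relation.Unary.Unique.Propositional using (Unique)
open import Data.List.Relation.Unary.Unique.Propositional.Properties using (map⁻)
open import Function.Bundles using (Equivalence)
open import Relation.Binary.PropositionalEquality
open import Relation.Binary.Definitions using (tri<; tri≈; tri>)
open import Relation.Nullary using (¬_; yes; no)
open import Relation.Nullary.Decidable using (⌊_⌋; fromWitness; fromWitnessFalse)

open Equivalence using (from)

_⊕_ : ∀ {r} → Fin r → Fin r → Fin r
_⊕_ {ℕ.suc r} k l = (toℕ k + toℕ l) mod ℕ.suc r

⊕-toℕ : ∀ {r} (k l : Fin (ℕ.suc r)) → toℕ (k ⊕ l) ≡ (toℕ k + toℕ l) % ℕ.suc r
⊕-toℕ {r} k l = toℕ-fromℕ< (m%n<n (toℕ k + toℕ l) (ℕ.suc r))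

-- Adding l ≤ d modulo d is undone by adding d ∸ l, hence it is injective on
-- the numbers below d.
+-mod-cancelʳ : ∀ d .{{_ : NonZero d}} {k k' l} → k ℕ.< d → k' ℕ.< d → l ℕ.≤ d →
                (k + l) % d ≡ (k' + l) % d → k ≡ k'
+-mod-cancelʳ d {k} {k'} {l} k<d k'<d l≤d eq = begin
  k                               ≡⟨ undo k<d ⟨
  ((k + l) % d + (d ∸ l) % d) % d  ≡⟨ cong (λ z → (z + (d ∸ l) % d) % d) eq ⟩
  ((k' + l) % d + (d ∸ l) % d) % d ≡⟨ undo k'<d ⟩
  k'                              ∎
  where
  open ≡-Reasoning
  undo : ∀ {j} → j ℕ.< d → ((j + l) % d + (d ∸ l) % d) % d ≡ j
  undo {j} j<d = begin
    ((j + l) % d + (d ∸ l) % d) % d ≡⟨ %-distribˡ-+ (j + l) (d ∸ l) d ⟨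
    (j + l + (d ∸ l)) % d           ≡⟨ cong (_% d) (+-assoc j l (d ∸ l)) ⟩
    (j + (l + (d ∸ l))) % d         ≡⟨ cong (λ z → (j + z) % d) (m+[n∸m]≡n l≤d) ⟩
    (j + d) % d                     ≡⟨ [m+n]%n≡m%n j d ⟩
    j % d                           ≡⟨ m<n⇒m%n≡m j<d ⟩
    j                               ∎

⊕-comm : ∀ {r} (k l : Fin r) → k ⊕ l ≡ l ⊕ k
⊕-comm {ℕ.suc r} k l = toℕ-injective (begin
  toℕ (k ⊕ l)                  ≡⟨ ⊕-toℕ k l ⟩
  (toℕ k + toℕ l) % ℕ.suc r    ≡⟨ cong (_% ℕ.suc r) (+-comm (toℕ k) (toℕ l)) ⟩
  (toℕ l + toℕ k) % ℕ.suc r    ≡⟨ ⊕-toℕ l k ⟨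
  toℕ (l ⊕ k)                  ∎)
  where open ≡-Reasoning

⊕-cancelʳ : ∀ {r} {k k' : Fin r} (l : Fin r) → k ⊕ l ≡ k' ⊕ l → k ≡ k'
⊕-cancelʳ {ℕ.suc r} {k} {k'} l eq = toℕ-injective
  (+-mod-cancelʳ (ℕ.suc r) (toℕ<n k) (toℕ<n k') (<⇒≤ (toℕ<n l))
    (trans (sym (⊕-toℕ k l)) (trans (cong toℕ eq) (⊕-toℕ k' l))))

⊕-cancelˡ : ∀ {r} (k : Fin r) {l l' : Fin r} → k ⊕ l ≡ k ⊕ l' → l ≡ l'
⊕-cancelˡ k {l} {l'} eq = ⊕-cancelʳ k (trans (⊕-comm l k) (trans eq (⊕-comm k l')))

module _ {n} {adj : Adj n} where

  head-vertex : ∀ {u v} (p : Walk adj u v) → u ∈ vertices p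
  head-vertex (stay _)   = here refl
  head-vertex (step _ _) = here refl

  edge-endpoints : ∀ {u v a b} (p : Walk adj u v) → (a , b) ∈ edges p →
                   a ∈ vertices p × b ∈ vertices p
  edge-endpoints (step _ p) (here refl) = here refl , there (head-vertex p)
  edge-endpoints (step _ p) (there ab∈p) =
    let a∈p , b∈p = edge-endpoints p ab∈p in there a∈p , there b∈p

  path-edge-distinct : ∀ {u v a b} (p : Walk adj u v) → IsPath p → (a , b) ∈ edges p → a ≢ b
  path-edge-distinct (step _ p) (u∉p ∷ _) (here refl) refl = All.lookup u∉p (head-vertex p) refl
  path-edge-distinct (step _ p) (_ ∷ p-path) (there ab∈p) = path-edge-distinct p p-path ab∈p

  disjoint-by-separation : ∀ {u v u' v'} {p : Walk adj u v} {q : Walk adj u' v'}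
    (R : Fin n → Fin n → Set) → (∀ {a b} → (a , b) ∈ edges p → R a b) →
    (∀ {a b} → (a , b) ∈ edges q → ¬ R a b × ¬ R b a) → EdgeDisjoint p q
  disjoint-by-separation R p-R q-¬R a b ab∈p =
    (λ ab∈q → proj₁ (q-¬R ab∈q) (p-R ab∈p)) , (λ ba∈q → proj₂ (q-¬R ba∈q) (p-R ab∈p))

module _ {n n'} {adj : Adj n} {adj' : Adj n'} (f : Fin n → Fin n') where

  EdgesOver : ∀ {u v u' v'} → Walk adj u v → Walk adj' u' v' → Set
  EdgesOver p P = ∀ {a b} → (a , b) ∈ edges p → (f a , f b) ∈ edges P

  disjoint-by-projection : ∀ {u v u' v' x y x' y'} {p : Walk adj u v} {q : Walk adj u' v'}
    {P : Walk adj' x y} {Q : Walk adj' x' y'} →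
    EdgesOver p P → EdgesOver q Q → EdgeDisjoint P Q → EdgeDisjoint p q
  disjoint-by-projection p/P q/Q P∥Q a b ab∈p =
    (λ ab∈q → proj₁ (P∥Q (f a) (f b) (p/P ab∈p)) (q/Q ab∈q)) ,
    (λ ba∈q → proj₂ (P∥Q (f a) (f b) (p/P ab∈p)) (q/Q ba∈q))

  path-by-projection : ∀ {u v x y} (p : Walk adj u v) (P : Walk adj' x y) →
    map f (vertices p) ≡ vertices P → IsPath P → IsPath p
  path-by-projection p P p↦P P-path = map⁻ (subst Unique (sym p↦P) P-path)

  over-avoids : ∀ {u v x y z a b} (p : Walk adj u v) (P : Walk adj' x y) → EdgesOver p P →
    All (z ≢_) (vertices P) → (a , b) ∈ edges p → f a ≢ z × f b ≢ z
  over-avoids p P p/P z∉P ab∈p =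
    let fa∈P , fb∈P = edge-endpoints P (p/P ab∈p)
    in (λ fa≡z → All.lookup z∉P fa∈P (sym fa≡z)) , (λ fb≡z → All.lookup z∉P fb∈P (sym fb≡z))

module _ {n m : ℕ} where

  π₁ : Fin (n * m) → Fin n
  π₁ x = proj₁ (remQuot {n} m x)

  π₂ : Fin (n * m) → Fin m
  π₂ x = proj₂ (remQuot {n} m x)

  π₁-combine : ∀ (g : Fin n) (h : Fin m) → π₁ (combine g h) ≡ g
  π₁-combine g h = cong proj₁ (remQuot-combine g h)

  π₂-combine : ∀ (g : Fin n) (h : Fin m) → π₂ (combine g h) ≡ h
  π₂-combine g h = cong proj₂ (remQuot-combine g h)

  coordinates-injective : ∀ {x y : Fin (n * m)} → π₁ x ≡ π₁ y → π₂ x ≡ π₂ y → x ≡ y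
  coordinates-injective {x} {y} eq₁ eq₂ =
    trans (sym (combine-remQuot {n} m x)) (trans (cong₂ (combine {n} {m}) eq₁ eq₂) (combine-remQuot {n} m y))

LexLess : ∀ {t r} → Fin t → Fin r → Fin t → Fin r → Set
LexLess a k a' l = a Fin.< a' ⊎ (a ≡ a' × k Fin.< l)

combine-lex : ∀ {t r} {a a' : Fin t} {k l : Fin r} → combine a k Fin.< combine a' l → LexLess a k a' l
combine-lex {r = r} {a} {a'} {k} {l} lt with <-cmp a a'
... | tri< a<a' _ _ = inj₁ a<a'
... | tri> _ _ a'<a = ⊥-elim (<-asym lt (combine-monoˡ-< l k a'<a))
... | tri≈ _ refl _ = inj₂ (refl , +-cancelˡ-< (r * toℕ a) (toℕ k) (toℕ l)
                                     (subst₂ ℕ._<_ (toℕ-combine a k) (toℕ-combine a l) lt))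

coordinates-lex : ∀ {t r} {x y : Fin (t * r)} → x Fin.< y → LexLess (π₁ {t} {r} x) (π₂ {t} x) (π₁ {t} y) (π₂ {t} y)
coordinates-lex {t} {r} {x} {y} lt =
  combine-lex (subst₂ Fin._<_ (sym (combine-remQuot {t} r x)) (sym (combine-remQuot {t} r y)) lt)

module Lex {n m} (G : Adj n) (H : Adj m) where

  pair : Fin n → Fin m → Fin (n * m)
  pair = combine

  π : Fin (n * m) → Fin n
  π = π₁ {n} {m}

  ρ : Fin (n * m) → Fin m
  ρ = π₂ {n} {m}

  edge-injective : ∀ {g₁ g₂ g₁' g₂' h₁ h₂ h₁' h₂'} →
    (pair g₁ h₁ , pair g₂ h₂) ≡ (pair g₁' h₁' , pair g₂' h₂') →
    (g₁ ≡ g₁' × h₁ ≡ h₁') × (g₂ ≡ g₂' × h₂ ≡ h₂')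
  edge-injective eq =
    let e₁ , e₂ = ,-injective eq
    in combine-injective _ _ _ _ e₁ , combine-injective _ _ _ _ e₂

  lex-pair : ∀ g h g' h' → lex G H (pair g h) (pair g' h') ≡ (G g g' ∨ (⌊ g ≟ g' ⌋ ∧ H h h'))
  lex-pair g h g' h' =
    cong₂ (λ x y → G (proj₁ x) (proj₁ y) ∨ (⌊ proj₁ x ≟ proj₁ y ⌋ ∧ H (proj₂ x) (proj₂ y)))
          (remQuot-combine g h) (remQuot-combine g' h')

  across-adjacent : ∀ {g g'} h h' → T (G g g') → T (lex G H (pair g h) (pair g' h'))
  across-adjacent {g} {g'} h h' e = subst T (sym (lex-pair g h g' h')) (from T-∨ (inj₁ e))

  within-adjacent : ∀ g {h h'} → T (H h h') → T (lex G H (pair g h) (pair g h'))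
  within-adjacent g {h} {h'} e =
    subst T (sym (lex-pair g h g h')) (from (T-∨ {G g g}) (inj₂ (from T-∧ (fromWitness {a? = g ≟ g} refl , e))))

  within : ∀ g {h h'} → Walk H h h' → Walk (lex G H) (pair g h) (pair g h')
  within g (stay h)   = stay (pair g h)
  within g (step e q) = step (within-adjacent g e) (within g q)

  within-vertices : ∀ g {h h'} (q : Walk H h h') → map ρ (vertices (within g q)) ≡ vertices q
  within-vertices g (stay h)           = cong (_∷ []) (π₂-combine g h)
  within-vertices g (step {u = h} e q) = cong₂ _∷_ (π₂-combine g h) (within-vertices g q)

  within-over : ∀ g {h h'} (q : Walk H h h') → EdgesOver ρ (within g q) q
  within-over g (step {u = h} {w = h'} e q) (here refl) = here (cong₂ _,_ (π₂-combine g h) (π₂-combine g h'))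
  within-over g (step e q) (there uv∈q) = there (within-over g q uv∈q)

  within-fibre : ∀ g {h h' u v} (q : Walk H h h') → (u , v) ∈ edges (within g q) → π u ≡ g × π v ≡ g
  within-fibre g (step {u = h} {w = h'} e q) (here refl) = π₁-combine g h , π₁-combine g h'
  within-fibre g (step e q) (there uv∈q) = within-fibre g q uv∈q

  within-isPath : ∀ g {h h'} (q : Walk H h h') → IsPath q → IsPath (within g q)
  within-isPath g q = path-by-projection ρ (within g q) q (within-vertices g q)

  -- The zigzag lift of the G-walk x w … y (first edge e, then p): its
  -- vertices carry the labels a, b, a, b, … and the last one carries β.
  zigzag : ∀ {x w y} (a b β : Fin m) → T (G x w) → Walk G w y → Walk (lex G H) (pair x a) (pair y β)
  zigzag a b β e (stay w)    = step (across-adjacent a β e) (stay _)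
  zigzag a b β e (step e' p) = step (across-adjacent a b e) (zigzag b a β e' p)

  zigzag-vertices : ∀ {x w y} (a b β : Fin m) (e : T (G x w)) (p : Walk G w y) →
                    map π (vertices (zigzag a b β e p)) ≡ vertices (step e p)
  zigzag-vertices {x} a b β e (stay w)    = cong₂ _∷_ (π₁-combine x a) (cong (_∷ []) (π₁-combine w β))
  zigzag-vertices {x} a b β e (step e' p) = cong₂ _∷_ (π₁-combine x a) (zigzag-vertices b a β e' p)

  zigzag-over : ∀ {x w y} (a b β : Fin m) (e : T (G x w)) (p : Walk G w y) →
                EdgesOver π (zigzag a b β e p) (step e p)
  zigzag-over {x} {w} a b β e (stay _)    (here refl) = here (cong₂ _,_ (π₁-combine x a) (π₁-combine w β))
  zigzag-over {x} {w} a b β e (step _ _)  (here refl) = here (cong₂ _,_ (π₁-combine x a) (π₁-combine w b))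
  zigzag-over         a b β e (step e' p) (there uv∈p) = there (zigzag-over b a β e' p uv∈p)

  -- Label choices (a , b ; β) and (a' , b' ; β') that never agree on a pair
  -- of consecutive labels of the zigzag; the condition is symmetric in a , b.
  Separated : (a b β a' b' β' : Fin m) → Set
  Separated a b β a' b' β' = ¬ (a ≡ a' × b ≡ b') × ¬ (a ≡ a' × β ≡ β') × ¬ (b ≡ b' × β ≡ β')

  -- Zigzag lifts of one G-path with separated labels are edge-disjoint: the
  -- i-th edges of both lie over the i-th edge of the path and differ in their
  -- labels, and edges at different positions lie over different edges.
  zigzag-disjoint : ∀ {x w y a b β a' b' β'} (e : T (G x w)) (p : Walk G w y) →
    Unique (x ∷ vertices p) → Separated a b β a' b' β' →
    EdgeDisjoint (zigzag a b β e p) (zigzag a' b' β' e p)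
  zigzag-disjoint e (stay w) (x∉ ∷ _) (_ , ¬aβ , _) _ _ (here refl) =
    (λ { (here eq) → let (_ , a≡a') , (_ , β≡β') = edge-injective eq in ¬aβ (a≡a' , β≡β')
       ; (there ()) }) ,
    (λ { (here eq) → All.head x∉ (sym (proj₁ (proj₁ (edge-injective eq))))
       ; (there ()) })
  zigzag-disjoint {x} {a = a} {b} {β} {a'} {b'} {β'} e (step e' p) (x∉ ∷ p-path) (¬ab , ¬aβ , ¬bβ) =
    head-and-tail
    where
    swapped : Separated b a β b' a' β'
    swapped = (λ (b≡b' , a≡a') → ¬ab (a≡a' , b≡b')) , ¬bβ , ¬aβ
    -- Edges after the first lie over the rest of the path, which avoids x.
    later : ∀ {u v} → (u , v) ∈ edges (zigzag b a β e' p) → π u ≢ x × π v ≢ x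
    later = over-avoids π (zigzag b a β e' p) (step e' p) (zigzag-over b a β e' p) x∉
    later' : ∀ {u v} → (u , v) ∈ edges (zigzag b' a' β' e' p) → π u ≢ x × π v ≢ x
    later' = over-avoids π (zigzag b' a' β' e' p) (step e' p) (zigzag-over b' a' β' e' p) x∉
    head-and-tail : EdgeDisjoint (zigzag a b β e (step e' p)) (zigzag a' b' β' e (step e' p))
    head-and-tail _ _ (here refl) =
      (λ { (here eq) → let (_ , a≡a') , (_ , b≡b') = edge-injective eq in ¬ab (a≡a' , b≡b')
         ; (there m) → proj₁ (later' m) (π₁-combine x a) }) ,
      (λ { (here eq) → All.head x∉ (sym (proj₁ (proj₁ (edge-injective eq))))
         ; (there m) → proj₂ (later' m) (π₁-combine x a) })
    head-and-tail u v (there uv∈q) =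
      (λ { (here eq) → proj₁ (later uv∈q) (trans (cong π (proj₁ (,-injective eq))) (π₁-combine x a'))
         ; (there m) → proj₁ (zigzag-disjoint e' p p-path swapped u v uv∈q) m }) ,
      (λ { (here eq) → proj₂ (later uv∈q) (trans (cong π (proj₁ (,-injective eq))) (π₁-combine x a'))
         ; (there m) → proj₂ (zigzag-disjoint e' p p-path swapped u v uv∈q) m })

  across : ∀ {x y} (α γ β : Fin m) → x ≢ y → Walk G x y → Walk (lex G H) (pair x α) (pair y β)
  across α γ β x≢y (stay x)   = ⊥-elim (x≢y refl)
  across α γ β _   (step e p) = zigzag α γ β e p

  across-isPath : ∀ {x y} (α γ β : Fin m) (x≢y : x ≢ y) (P : Walk G x y) →
                  IsPath P → IsPath (across α γ β x≢y P)
  across-isPath α γ β x≢y (stay x)   = ⊥-elim (x≢y refl)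
  across-isPath α γ β _   (step e p) = path-by-projection π (zigzag α γ β e p) (step e p) (zigzag-vertices α γ β e p)

  across-over : ∀ {x y} (α γ β : Fin m) (x≢y : x ≢ y) (P : Walk G x y) → EdgesOver π (across α γ β x≢y P) P
  across-over α γ β x≢y (stay x)   = ⊥-elim (x≢y refl)
  across-over α γ β _   (step e p) = zigzag-over α γ β e p

  across-disjoint : ∀ {x y α γ β α' γ' β'} (x≢y : x ≢ y) (P : Walk G x y) → IsPath P →
    Separated α γ β α' γ' β' → EdgeDisjoint (across α γ β x≢y P) (across α' γ' β' x≢y P)
  across-disjoint x≢y (stay x)   = ⊥-elim (x≢y refl)
  across-disjoint _   (step e p) = zigzag-disjoint e p

K-edge : ∀ {s} {i j : Fin s} → i Fin.< j → T (K s i j)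
K-edge i<j = fromWitnessFalse (<⇒≢ i<j)

module Construction {n m t r} {G : Adj n} {H : Adj m}
                    (imG : Immersion (K t) G) (imH : Immersion (K r) H) where
  open Lex G H
  module IG = Immersion imG
  module IH = Immersion imH
  open IG using (φ)
  open IH using () renaming (φ to ψ)

  pathG : ∀ {a a'} (a<a' : a Fin.< a') → Walk G (φ a) (φ a')
  pathG {a} {a'} a<a' = IG.path a a' a<a' (K-edge a<a')

  pathH : ∀ {k l} (k<l : k Fin.< l) → Walk H (ψ k) (ψ l)
  pathH {k} {l} k<l = IH.path k l k<l (K-edge k<l)

  pathG-isPath : ∀ {a a'} (a<a' : a Fin.< a') → IsPath (pathG a<a')
  pathG-isPath {a} {a'} a<a' = IG.path-isPath a a' a<a' (K-edge a<a')

  pathH-isPath : ∀ {k l} (k<l : k Fin.< l) → IsPath (pathH k<l)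
  pathH-isPath {k} {l} k<l = IH.path-isPath k l k<l (K-edge k<l)

  φ-distinct : ∀ {a a'} → a Fin.< a' → φ a ≢ φ a'
  φ-distinct a<a' φa≡φa' = <⇒≢ a<a' (IG.φ-inj φa≡φa')

  vertex : Fin t → Fin r → Fin (n * m)
  vertex a k = pair (φ a) (ψ k)

  link : ∀ {a k a' l} → LexLess a k a' l → Walk (lex G H) (vertex a k) (vertex a' l)
  link {k = k} {l = l} (inj₁ a<a')      = across (ψ k) (ψ (k ⊕ l)) (ψ l) (φ-distinct a<a') (pathG a<a')
  link {a = a}         (inj₂ (refl , k<l)) = within (φ a) (pathH k<l)

  link-isPath : ∀ {a k a' l} (o : LexLess a k a' l) → IsPath (link o)
  link-isPath {k = k} {l = l} (inj₁ a<a') =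
    across-isPath (ψ k) (ψ (k ⊕ l)) (ψ l) (φ-distinct a<a') (pathG a<a') (pathG-isPath a<a')
  link-isPath {a = a} (inj₂ (refl , k<l)) = within-isPath (φ a) (pathH k<l) (pathH-isPath k<l)

  -- Distinct label pairs give separated zigzags: this is where the Latin
  -- square property of ⊕ is used.
  labels-separated : ∀ {k l k' l'} → (k ≡ k' → l ≡ l' → ⊥) →
    Separated (ψ k) (ψ (k ⊕ l)) (ψ l) (ψ k') (ψ (k' ⊕ l')) (ψ l')
  labels-separated {k} {l} {k'} {l'} k,l≢k',l' = same-start-middle , same-start-end , same-middle-end
    where
    same-start-middle : ¬ (ψ k ≡ ψ k' × ψ (k ⊕ l) ≡ ψ (k' ⊕ l'))
    same-start-middle (ψk≡ , ψk⊕l≡) with refl ← IH.φ-inj ψk≡ = k,l≢k',l' refl (⊕-cancelˡ k (IH.φ-inj ψk⊕l≡))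
    same-start-end : ¬ (ψ k ≡ ψ k' × ψ l ≡ ψ l')
    same-start-end (ψk≡ , ψl≡) = k,l≢k',l' (IH.φ-inj ψk≡) (IH.φ-inj ψl≡)
    same-middle-end : ¬ (ψ (k ⊕ l) ≡ ψ (k' ⊕ l') × ψ l ≡ ψ l')
    same-middle-end (ψk⊕l≡ , ψl≡) with refl ← IH.φ-inj ψl≡ = k,l≢k',l' (⊕-cancelʳ l (IH.φ-inj ψk⊕l≡)) refl

  -- Links between different pairs (a , a') of G-vertices lie over
  -- edge-disjoint G-paths.
  zigzags-over-different-paths : ∀ {a k a' l b k' b' l'} (a<a' : a Fin.< a') (b<b' : b Fin.< b') →
    (a , a') ≢ (b , b') → EdgeDisjoint (link {a} {k} {a'} {l} (inj₁ a<a')) (link {b} {k'} {b'} {l'} (inj₁ b<b'))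
  zigzags-over-different-paths {a} {k} {a'} {l} {b} {k'} {b'} {l'} a<a' b<b' aa'≢bb' =
    disjoint-by-projection π
      (across-over (ψ k) (ψ (k ⊕ l)) (ψ l) (φ-distinct a<a') (pathG a<a'))
      (across-over (ψ k') (ψ (k' ⊕ l')) (ψ l') (φ-distinct b<b') (pathG b<b'))
      (IG.disjoint a a' b b' a<a' (K-edge a<a') b<b' (K-edge b<b') aa'≢bb')

  -- Links over the same G-path are zigzags with separated labels.
  zigzags-over-same-path : ∀ {a k a' l k' l'} (a<a' : a Fin.< a') → (k ≡ k' → l ≡ l' → ⊥) →
    EdgeDisjoint (link {a} {k} {a'} {l} (inj₁ a<a')) (link {a} {k'} {a'} {l'} (inj₁ a<a'))
  zigzags-over-same-path a<a' k,l≢k',l' =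
    across-disjoint (φ-distinct a<a') (pathG a<a') (pathG-isPath a<a') (labels-separated k,l≢k',l')

  -- Every edge of a zigzag changes the G-coordinate, no edge inside a fibre does.
  zigzag-fibre-disjoint : ∀ {a k a' l b k' l'} (a<a' : a Fin.< a') (k'<l' : k' Fin.< l') →
    EdgeDisjoint (link {a} {k} {a'} {l} (inj₁ a<a')) (link {b} {k'} {b} {l'} (inj₂ (refl , k'<l')))
  zigzag-fibre-disjoint {k = k} {l = l} {b} a<a' k'<l' =
    disjoint-by-separation (λ u v → π u ≢ π v)
      (λ uv∈p → path-edge-distinct (pathG a<a') (pathG-isPath a<a')
                  (across-over (ψ k) (ψ (k ⊕ l)) (ψ l) (φ-distinct a<a') (pathG a<a') uv∈p))
      (λ uv∈q → let πu≡ , πv≡ = within-fibre (φ b) (pathH k'<l') uv∈q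
                in (λ πu≢πv → πu≢πv (trans πu≡ (sym πv≡))) , (λ πv≢πu → πv≢πu (trans πv≡ (sym πu≡))))

  fibre-zigzag-disjoint : ∀ {a k l b k' b' l'} (k<l : k Fin.< l) (b<b' : b Fin.< b') →
    EdgeDisjoint (link {a} {k} {a} {l} (inj₂ (refl , k<l))) (link {b} {k'} {b'} {l'} (inj₁ b<b'))
  fibre-zigzag-disjoint {a} {k' = k'} {l' = l'} k<l b<b' =
    disjoint-by-separation (λ u v → π u ≡ π v)
      (λ uv∈p → let πu≡ , πv≡ = within-fibre (φ a) (pathH k<l) uv∈p in trans πu≡ (sym πv≡))
      (λ uv∈q → let πu≢πv = path-edge-distinct (pathG b<b') (pathG-isPath b<b')
                              (across-over (ψ k') (ψ (k' ⊕ l')) (ψ l') (φ-distinct b<b') (pathG b<b') uv∈q)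
                in πu≢πv , (λ πv≡πu → πu≢πv (sym πv≡πu)))

  -- Links inside one fibre are copies of edge-disjoint H-paths; links in
  -- different fibres share no vertex.
  fibres-disjoint : ∀ {a k l b k' l'} (k<l : k Fin.< l) (k'<l' : k' Fin.< l') → (a ≡ b → k ≡ k' → l ≡ l' → ⊥) →
    EdgeDisjoint (link {a} {k} {a} {l} (inj₂ (refl , k<l))) (link {b} {k'} {b} {l'} (inj₂ (refl , k'<l')))
  fibres-disjoint {a} {k} {l} {b} {k'} {l'} k<l k'<l' distinct with a ≟ b
  ... | yes refl =
    disjoint-by-projection ρ (within-over (φ a) (pathH k<l)) (within-over (φ a) (pathH k'<l'))
      (IH.disjoint k l k' l' k<l (K-edge k<l) k'<l' (K-edge k'<l')
        (λ kl≡k'l' → distinct refl (cong proj₁ kl≡k'l') (cong proj₂ kl≡k'l')))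
  ... | no a≢b =
    disjoint-by-separation (λ u v → π u ≡ φ a)
      (λ uv∈p → proj₁ (within-fibre (φ a) (pathH k<l) uv∈p))
      (λ uv∈q → let πu≡ , πv≡ = within-fibre (φ b) (pathH k'<l') uv∈q
                in (λ πu≡φa → a≢b (IG.φ-inj (trans (sym πu≡φa) πu≡))) ,
                   (λ πv≡φa → a≢b (IG.φ-inj (trans (sym πv≡φa) πv≡))))

  link-disjoint : ∀ {a k a' l b k' b' l'} (o : LexLess a k a' l) (o' : LexLess b k' b' l') →
    (a ≡ b → k ≡ k' → a' ≡ b' → l ≡ l' → ⊥) → EdgeDisjoint (link o) (link o')
  link-disjoint {a} {_} {a'} {_} {b} {_} {b'} (inj₁ a<a') (inj₁ b<b') distinct with a ≟ b | a' ≟ b'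
  ... | yes refl | yes refl with refl ← <-irrelevant a<a' b<b' =
    zigzags-over-same-path a<a' (λ k≡k' l≡l' → distinct refl k≡k' refl l≡l')
  ... | no a≢b   | _        = zigzags-over-different-paths a<a' b<b' (λ aa'≡bb' → a≢b (cong proj₁ aa'≡bb'))
  ... | yes _    | no a'≢b' = zigzags-over-different-paths a<a' b<b' (λ aa'≡bb' → a'≢b' (cong proj₂ aa'≡bb'))
  link-disjoint (inj₁ a<a') (inj₂ (refl , k'<l')) _ = zigzag-fibre-disjoint a<a' k'<l'
  link-disjoint (inj₂ (refl , k<l)) (inj₁ b<b') _ = fibre-zigzag-disjoint k<l b<b'
  link-disjoint (inj₂ (refl , k<l)) (inj₂ (refl , k'<l')) distinct =
    fibres-disjoint k<l k'<l' (λ a≡b k≡k' l≡l' → distinct a≡b k≡k' a≡b l≡l')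

  -- The vertex x of K_{tr}, viewed as the pair (π₁ x , π₂ x) ∈ Fin t × Fin r,
  -- goes to (φ (π₁ x) , ψ (π₂ x)); the edge x < y is realised by the link
  -- for the lexicographic comparison of their coordinates.
  lex-immersion : Immersion (K (t * r)) (lex G H)
  lex-immersion = record
    { φ           = λ x → vertex (π₁ {t} x) (π₂ {t} x)
    ; φ-inj       = λ eq → let φ≡ , ψ≡ = combine-injective _ _ _ _ eq
                           in coordinates-injective (IG.φ-inj φ≡) (IH.φ-inj ψ≡)
    ; path        = λ x y x<y _ → link (coordinates-lex x<y)
    ; path-isPath = λ x y x<y _ → link-isPath (coordinates-lex x<y)
    ; disjoint    = λ x y x' y' x<y _ x'<y' _ xy≢x'y' →
        link-disjoint (coordinates-lex x<y) (coordinates-lex x'<y')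
          (λ x₁≡ x₂≡ y₁≡ y₂≡ → xy≢x'y' (cong₂ _,_ (coordinates-injective x₁≡ x₂≡) (coordinates-injective y₁≡ y₂≡)))
    }

theorem4 : ∀ {n m} (G : Adj n) (H : Adj m) (t r : ℕ) →
           IsSimple G → IsSimple H → ImNum G t → ImNum H r →
           ImAtLeast (lex G H) (t * r)
theorem4 G H t r _ _ (imG , _) (imH , _) = t * r , ≤-refl , Construction.lex-immersion imG imH
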